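{- Two LPMLN programs $P$ and $Q$ are semi-strongly equivalent if and only if $\mathrm{SE}(P)=\mathrm{SE}(Q)$.
   Context: All programs are finite and ground. A literal is an atom $a$ or its classical negation $\neg a$. An ASP rule $r$ has the form $l_1\vee\cdots\vee l_k\leftarrow l_{k+1},\dots,l_m,\ not\ l_{m+1},\dots,\ not\ l_n$ with literals $l_i$; write $h(r)=\{l_1,\dots,l_k\}$, $b^+(r)=\{l_{k+1},\dots,l_m\}$, $b^-(r)=\{l_{m+1},\dots,l_n\}$. An interpretation is a set of literals not containing both $a$ and $\neg a$ for any atom $a$. $I\models r$ iff ($b^+(r)\subseteq I$ and $b^-(r)\cap I=\emptyset$) implies $h(r)\cap I\neq\emptyset$. For an ASP program $\Pi$ the GL-reduct is $\Pi^I=\{h(r)\leftarrow b^+(r) : r\in\Pi,\ b^-(r)\cap I=\emptyset\}$, and $I$ is a stable model of $\Pi$ iff $I\models\Pi^I$ and no proper subset of $I$ satisfies $\Pi^I$. An LPMLN program $P$ is a finite set of weighted rules $w:r$, where $r$ is an ASP rule and $w$ is either a real number or the symbol $\alpha$; $\overline{P}=\{r : w:r\in P\}$. For an interpretation $I$, $P_I=\{w:r\in P : I\models r\}$; $I$ is a stable model of $P$ iff $I$ is a stable model of the ASP program $\overline{P_I}$; $\mathrm{SM}(P)$ is the set of stable models of $P$. $P$ and $Q$ are semi-strongly equivalent iff $\mathrm{SM}(P\cup R)=\mathrm{SM}(Q\cup R)$ for every LPMLN program $R$. An SE-interpretation is a pair $(X,Y)$ of interpretations with $X\subseteq Y$;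 it is an SE-model of $P$ iff $X\models(\overline{P_Y})^Y$; $\mathrm{SE}(P)$ is the set of SE-models of $P$. -}

module Defs where

open import Data.Nat using (ℕ)
open import Data.Fin using (Fin)
open import Data.Bool using (Bool; true; false; not; _∧_; _∨_)
open import Data.List using (List; []; _∷_; map; filterᵇ; _++_)
open import Data.Bool.ListAction using (any; all)
open import Data.Product using (_×_; _,_; proj₂; ∃-syntax)
open import Relation.Nullary using (¬_)
open import Relation.Binary.PropositionalEquality using (_≡_)

-- A finite propositional signature: atoms are Fin n.
-- Literals: an atom a or its classical negation ¬a.
data Lit (n : ℕ) : Set where
  pos : Fin n → Lit n
  neg : Fin n → Lit n

-- ASP rule  l1 ∨ … ∨ lk ← l(k+1), …, lm, not l(m+1), …, not ln
record Rule (n : ℕ) : Set where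
  constructor mkRule
  field
    head  : List (Lit n)
    bpos  : List (Lit n)
    bneg  : List (Lit n)
open Rule public

ASP : ℕ → Set
ASP n = List (Rule n)

LitSet : ℕ → Set
LitSet n = Lit n → Bool

Consistent : ∀ {n} → LitSet n → Set
Consistent I = ∀ a → ¬ (I (pos a) ≡ true × I (neg a) ≡ true)

_⊆ˡ_ : ∀ {n} → LitSet n → LitSet n → Set
X ⊆ˡ Y = ∀ l → X l ≡ true → Y l ≡ true

_⊂ˡ_ : ∀ {n} → LitSet n → LitSet n → Set
X ⊂ˡ Y = X ⊆ˡ Y × ∃[ l ] (Y l ≡ true × X l ≡ false)

satRuleᵇ : ∀ {n} → LitSet n → Rule n → Bool
satRuleᵇ I r = not (all I (bpos r) ∧ not (any I (bneg r))) ∨ any I (head r)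

_⊨_ : ∀ {n} → LitSet n → ASP n → Set
I ⊨ Π = all (satRuleᵇ I) Π ≡ true

reduct : ∀ {n} → ASP n → LitSet n → ASP n
reduct [] I = []
reduct (r ∷ Π) I with any I (bneg r)
... | true  = reduct Π I
... | false = mkRule (head r) (bpos r) [] ∷ reduct Π I

StableASP : ∀ {n} → ASP n → LitSet n → Set
StableASP Π I =
  Consistent I × I ⊨ reduct Π I × (∀ J → J ⊂ˡ I → ¬ (J ⊨ reduct Π I))

WRule : Set → ℕ → Set
WRule W n = W × Rule n

LPMLN : Set → ℕ → Set
LPMLN W n = List (WRule W n)

bar : ∀ {W n} → LPMLN W n → ASP n
bar P = map proj₂ P

restrict : ∀ {W n} → LPMLN W n → LitSet n → LPMLN W n
restrict P I = filterᵇ (λ wr → satRuleᵇ I (proj₂ wr)) P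

Stable : ∀ {W n} → LPMLN W n → LitSet n → Set
Stable P I = StableASP (bar (restrict P I)) I

SemiStronglyEquiv : ∀ {W n} → LPMLN W n → LPMLN W n → Set
SemiStronglyEquiv {W} {n} P Q =
  ∀ (R : LPMLN W n) (I : LitSet n) →
    (Stable (P ++ R) I → Stable (Q ++ R) I) ×
    (Stable (Q ++ R) I → Stable (P ++ R) I)

SEModel : ∀ {W n} → LPMLN W n → LitSet n → LitSet n → Set
SEModel P X Y =
  Consistent X × Consistent Y × X ⊆ˡ Y × X ⊨ reduct (bar (restrict P Y)) Y

SameSE : ∀ {W n} → LPMLN W n → LPMLN W n → Set
SameSE P Q = ∀ X Y → (SEModel P X Y → SEModel Q X Y) × (SEModel Q X Y → SEModel P X Y)

-- SE(Q) ⊆ SE(P) holds iff SM(P ∪ R) ⊆ SM(Q ∪ R) for every R.  Since Y always satisfies its own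
-- reduct (P_Y‾)^Y, Y ∈ SM(P ∪ R) says exactly that no proper SE-model (X, Y) of P is also one of
-- R, which gives the direction from SE-models to stable models.  Conversely, given a proper
-- SE-model (X, Y) of P and l₀ ∈ Y ∖ X, let R = X ∪ { l₀ ← l : l ∉ X } ∪ { l ← l₀ : all l }.
-- Every J ⊂ Y satisfying (R_Y‾)^Y contains X and misses some l ∈ Y, hence (by l ← l₀) misses l₀
-- and then (by l₀ ← l) every l ∉ X; so J = X.  If (X, Y) were not an SE-model of Q, Y would be a
-- stable model of Q ∪ R but not of P ∪ R, since (X, Y) is an SE-model of both P and R.
module Submission where

open import Defs
open import Data.Nat using (ℕ)
open import Data.Bool using (true; false; not; _∧_; _∨_; if_then_else_)
open import Data.Bool.Properties using (_≟_; ∨-identityʳ)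
open import Data.Bool.ListAction using (and; or; all; any)
open import Data.List using (List; []; _∷_; map; _++_; allFin)
open import Data.List.Properties using (map-++; map-∘; map-id; map-cong; filter-++)
open import Data.List.Relation.Unary.Any using (here; there; any?; satisfied)
open import Data.List.Membership.Propositional using (_∈_; lose)
open import Data.List.Membership.Propositional.Properties
  using (∈-map⁺; ∈-map⁻; ∈-++⁺ˡ; ∈-++⁺ʳ; ∈-++⁻; ∈-allFin)
open import Data.Product using (_×_; _,_; proj₁; proj₂)
open import Data.Sum using (_⊎_; inj₁; inj₂)
open import Data.Empty using (⊥-elim)
open import Function using (_∘_)
open import Relation.Nullary using (¬_; yes; no)
open import Relation.Nullary.Decidable using (decidable-stable; _×-dec_)
open import Relation.Binary.PropositionalEquality
  using (_≡_; refl; sym; trans; cong; cong₂; subst; _≗_; module ≡-Reasoning)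

private
  variable
    W : Set
    n : ℕ
    X Y J I : LitSet n
    Π Σ : ASP n
    P Q R : LPMLN W n
    a b l₀ l₁ : Lit n

∧-true⁻ : ∀ {x y} → x ∧ y ≡ true → x ≡ true × y ≡ true
∧-true⁻ {true}  y≡true = refl , y≡true
∧-true⁻ {false} ()

∧-true⁺ : ∀ {x y} → x ≡ true → y ≡ true → x ∧ y ≡ true
∧-true⁺ refl y≡true = y≡true

⊨-++⁻ : ∀ Π → J ⊨ (Π ++ Σ) → J ⊨ Π × J ⊨ Σ
⊨-++⁻ []      J⊨Σ = refl , J⊨Σ
⊨-++⁻ (r ∷ Π) J⊨ =
  let J⊨r , J⊨Π++Σ = ∧-true⁻ J⊨ ; J⊨Π , J⊨Σ = ⊨-++⁻ Π J⊨Π++Σ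
  in ∧-true⁺ J⊨r J⊨Π , J⊨Σ

⊨-++⁺ : ∀ Π → J ⊨ Π → J ⊨ Σ → J ⊨ (Π ++ Σ)
⊨-++⁺ []      _  J⊨Σ = J⊨Σ
⊨-++⁺ (r ∷ Π) J⊨ J⊨Σ =
  let J⊨r , J⊨Π = ∧-true⁻ J⊨ in ∧-true⁺ J⊨r (⊨-++⁺ Π J⊨Π J⊨Σ)

satRuleᵇ-cong : X ≗ J → satRuleᵇ X ≗ satRuleᵇ J
satRuleᵇ-cong X≗J r =
  cong₂ (λ body h → not body ∨ h)
        (cong₂ (λ p m → p ∧ not m) (cong and (map-cong X≗J (bpos r))) (cong or (map-cong X≗J (bneg r))))
        (cong or (map-cong X≗J (head r)))

⊨-resp-≗ : ∀ Π → X ≗ J → X ⊨ Π → J ⊨ Π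
⊨-resp-≗ Π X≗J = trans (sym (cong and (map-cong (satRuleᵇ-cong X≗J) Π)))

Consistent-⊆ˡ : X ⊆ˡ Y → Consistent Y → Consistent X
Consistent-⊆ˡ X⊆Y cY a (Xa , X¬a) = cY a (X⊆Y _ Xa , X⊆Y _ X¬a)

seReduct : LPMLN W n → LitSet n → ASP n
seReduct P Y = reduct (bar (restrict P Y)) Y

positive : Rule n → Rule n
positive r = mkRule (head r) (bpos r) []

reduct-++ : ∀ Π → reduct (Π ++ Σ) Y ≡ reduct Π Y ++ reduct Σ Y
reduct-++ [] = refl
reduct-++ {Y = Y} (r ∷ Π) with any Y (bneg r)
... | true  = reduct-++ Π
... | false = cong (positive r ∷_) (reduct-++ Π)

seReduct-++ : ∀ (P : LPMLN W n) → seReduct (P ++ R) Y ≡ seReduct P Y ++ seReduct R Y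
seReduct-++ {R = R} {Y = Y} P = begin
  reduct (bar (restrict (P ++ R) Y)) Y
    ≡⟨ cong (λ S → reduct (bar S) Y) (filter-++ _ P R) ⟩
  reduct (bar (restrict P Y ++ restrict R Y)) Y
    ≡⟨ cong (λ Π → reduct Π Y) (map-++ proj₂ (restrict P Y) (restrict R Y)) ⟩
  reduct (bar (restrict P Y) ++ bar (restrict R Y)) Y
    ≡⟨ reduct-++ (bar (restrict P Y)) ⟩
  seReduct P Y ++ seReduct R Y ∎
  where open ≡-Reasoning

⊨-seReduct-++⁻ : ∀ (P R : LPMLN W n) → J ⊨ seReduct (P ++ R) Y → J ⊨ seReduct P Y × J ⊨ seReduct R Y
⊨-seReduct-++⁻ P R J⊨ = ⊨-++⁻ (seReduct P _) (subst (_ ⊨_) (seReduct-++ P) J⊨)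

⊨-seReduct-++⁺ : ∀ (P R : LPMLN W n) → J ⊨ seReduct P Y → J ⊨ seReduct R Y → J ⊨ seReduct (P ++ R) Y
⊨-seReduct-++⁺ P R J⊨P J⊨R = subst (_ ⊨_) (sym (seReduct-++ P)) (⊨-++⁺ (seReduct P _) J⊨P J⊨R)

satRuleᵇ-positive : ∀ r → any J (bneg r) ≡ false → satRuleᵇ J (positive r) ≡ satRuleᵇ J r
satRuleᵇ-positive r J∩b⁻≡∅ rewrite J∩b⁻≡∅ = refl

⊨-reduct-self : ∀ Π → Y ⊨ Π → Y ⊨ reduct Π Y
⊨-reduct-self [] _ = refl
⊨-reduct-self {Y = Y} (r ∷ Π) Y⊨ with any Y (bneg r) in Y∩b⁻ | ∧-true⁻ Y⊨
... | true  | _ , Y⊨Π = ⊨-reduct-self Π Y⊨Π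
... | false | Y⊨r , Y⊨Π =
  ∧-true⁺ (trans (satRuleᵇ-positive r Y∩b⁻) Y⊨r) (⊨-reduct-self Π Y⊨Π)

⊨-bar-restrict : ∀ (P : LPMLN W n) → Y ⊨ bar (restrict P Y)
⊨-bar-restrict [] = refl
⊨-bar-restrict {Y = Y} ((_ , r) ∷ P) with satRuleᵇ Y r in Y⊨r
... | true  = ∧-true⁺ Y⊨r (⊨-bar-restrict P)
... | false = ⊨-bar-restrict P

⊨-seReduct-self : ∀ (P : LPMLN W n) → Y ⊨ seReduct P Y
⊨-seReduct-self {Y = Y} P = ⊨-reduct-self (bar (restrict P Y)) (⊨-bar-restrict P)

⊨-seReduct⁻ : ∀ {r} (P : LPMLN W n) → J ⊨ seReduct P Y → r ∈ bar P →
  satRuleᵇ Y r ≡ true → any Y (bneg r) ≡ false → satRuleᵇ J (positive r) ≡ true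
⊨-seReduct⁻ {Y = Y} ((_ , r′) ∷ P) J⊨ r∈ Y⊨r Y∩b⁻ with satRuleᵇ Y r′ in Y⊨r′ | r∈
... | false | here refl with () ← trans (sym Y⊨r) Y⊨r′
... | false | there r∈P = ⊨-seReduct⁻ P J⊨ r∈P Y⊨r Y∩b⁻
... | true  | _ with any Y (bneg r′) in Y∩b⁻′ | r∈
...   | true  | here refl with () ← trans (sym Y∩b⁻′) Y∩b⁻
...   | true  | there r∈P = ⊨-seReduct⁻ P J⊨ r∈P Y⊨r Y∩b⁻
...   | false | here refl = proj₁ (∧-true⁻ J⊨)
...   | false | there r∈P = ⊨-seReduct⁻ P (proj₂ (∧-true⁻ J⊨)) r∈P Y⊨r Y∩b⁻

⊨-seReduct⁺ : ∀ (P : LPMLN W n) →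
  (∀ {r} → r ∈ bar P → satRuleᵇ Y r ≡ true → any Y (bneg r) ≡ false →
     satRuleᵇ J (positive r) ≡ true) →
  J ⊨ seReduct P Y
⊨-seReduct⁺ [] _ = refl
⊨-seReduct⁺ {Y = Y} ((_ , r) ∷ P) H with satRuleᵇ Y r in Y⊨r
... | false = ⊨-seReduct⁺ P (λ r∈ → H (there r∈))
... | true with any Y (bneg r) | H (here refl) Y⊨r
...   | true  | _        = ⊨-seReduct⁺ P (λ r∈ → H (there r∈))
...   | false | J⊨r⁺ = ∧-true⁺ (J⊨r⁺ refl) (⊨-seReduct⁺ P (λ r∈ → H (there r∈)))

lits : (n : ℕ) → List (Lit n)
lits n = map pos (allFin n) ++ map neg (allFin n)

∈-lits : (l : Lit n) → l ∈ lits n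
∈-lits     (pos a) = ∈-++⁺ˡ (∈-map⁺ pos (∈-allFin a))
∈-lits {n} (neg a) = ∈-++⁺ʳ (map pos (allFin n)) (∈-map⁺ neg (∈-allFin a))

⊆ˡ⇒≗⊎⊂ˡ : X ⊆ˡ Y → X ≗ Y ⊎ X ⊂ˡ Y
⊆ˡ⇒≗⊎⊂ˡ {n} {X} {Y} X⊆Y with any? (λ l → (Y l ≟ true) ×-dec (X l ≟ false)) (lits n)
... | yes Y∖X≢∅ = inj₂ (X⊆Y , satisfied Y∖X≢∅)
... | no  Y∖X≡∅ = inj₁ λ l → agree l (λ l∈Y∖X → Y∖X≡∅ (lose (∈-lits l) l∈Y∖X))
  where
  agree : ∀ l → ¬ (Y l ≡ true × X l ≡ false) → X l ≡ Y l
  agree l l∉Y∖X with X l in Xl | Y l in Yl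
  ... | true  | true  = refl
  ... | false | false = refl
  ... | true  | false with () ← trans (sym (X⊆Y l Xl)) Yl
  ... | false | true  = ⊥-elim (l∉Y∖X (refl , refl))

fact : Lit n → Rule n
fact a = mkRule (a ∷ []) [] []

infix 5 _⇐_
_⇐_ : Lit n → Lit n → Rule n
a ⇐ b = mkRule (a ∷ []) (b ∷ []) []

satRuleᵇ-fact : ∀ a → satRuleᵇ J (fact a) ≡ J a
satRuleᵇ-fact {J = J} a = ∨-identityʳ (J a)

⇐-by-head : J a ≡ true → satRuleᵇ J (a ⇐ b) ≡ true
⇐-by-head {J = J} {b = b} Ja rewrite Ja with J b
... | true  = refl
... | false = refl

⇐-by-body : J b ≡ false → satRuleᵇ J (a ⇐ b) ≡ true
⇐-by-body Jb rewrite Jb = refl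

⇐-mp : satRuleᵇ J (a ⇐ b) ≡ true → J b ≡ true → J a ≡ true
⇐-mp {J = J} {a} {b} J⊨a⇐b Jb with J a | J b | J⊨a⇐b | Jb
... | true  | _ | _  | _ = refl
... | false | true | () | _
... | false | false | _ | ()

weighted : W → ASP n → LPMLN W n
weighted w = map (w ,_)

bar-weighted : ∀ (w : W) (Π : ASP n) → bar (weighted w Π) ≡ Π
bar-weighted w Π = trans (sym (map-∘ Π)) (map-id Π)

countermodel : LitSet n → Lit n → ASP n
countermodel {n} X l₀ = map (λ l → if X l then fact l else l₀ ⇐ l) (lits n) ++ map (_⇐ l₀) (lits n)

countermodel-∈ˡ : ∀ {b} l → X l ≡ b → (if b then fact l else l₀ ⇐ l) ∈ countermodel X l₀
countermodel-∈ˡ l refl = ∈-++⁺ˡ (∈-map⁺ _ (∈-lits l))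

countermodel-∈ʳ : ∀ l → (l ⇐ l₀) ∈ countermodel X l₀
countermodel-∈ʳ {l₀ = l₀} l = ∈-++⁺ʳ _ (∈-map⁺ (_⇐ l₀) (∈-lits l))

countermodel-SEModel : ∀ (w : W) X Y → X l₀ ≡ false → X ⊨ seReduct (weighted w (countermodel X l₀)) Y
countermodel-SEModel {l₀ = l₀} w X Y Xl₀ =
  ⊨-seReduct⁺ (weighted w (countermodel X l₀))
    (λ r∈ _ _ → X⊨ (subst (_ ∈_) (bar-weighted w (countermodel X l₀)) r∈))
  where
  X⊨ : ∀ {r} → r ∈ countermodel X l₀ → satRuleᵇ X (positive r) ≡ true
  X⊨ r∈ with ∈-++⁻ (map (λ l → if X l then fact l else l₀ ⇐ l) (lits _)) r∈
  ... | inj₂ r∈ʳ with ∈-map⁻ (_⇐ l₀) r∈ʳ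
  ...   | l , _ , refl = ⇐-by-body {J = X} Xl₀
  X⊨ r∈ | inj₁ r∈ˡ with ∈-map⁻ (λ l → if X l then fact l else l₀ ⇐ l) r∈ˡ
  ...   | l , _ , refl with X l in Xl
  ...     | true  = trans (satRuleᵇ-fact {J = X} l) Xl
  ...     | false = ⇐-by-body {J = X} Xl

countermodel-forces : ∀ (w : W) → X ⊆ˡ Y → Y l₀ ≡ true → Y l₁ ≡ true → J l₁ ≡ false →
  J ⊨ seReduct (weighted w (countermodel X l₀)) Y → X ≗ J
countermodel-forces {X = X} {Y = Y} {l₀ = l₀} {l₁ = l₁} {J = J} w X⊆Y Yl₀ Yl₁ Jl₁ J⊨ = agree
  where
  holds : ∀ {r} → r ∈ countermodel X l₀ → satRuleᵇ Y r ≡ true → any Y (bneg r) ≡ false →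
    satRuleᵇ J (positive r) ≡ true
  holds r∈ = ⊨-seReduct⁻ (weighted w (countermodel X l₀)) J⊨
    (subst (_ ∈_) (sym (bar-weighted w (countermodel X l₀))) r∈)

  Jl₀ : J l₀ ≡ false
  Jl₀ with J l₀ in J∋l₀
  ... | false = refl
  ... | true with () ← trans (sym Jl₁)
                        (⇐-mp {J = J} (holds (countermodel-∈ʳ l₁) (⇐-by-head {J = Y} Yl₁) refl) J∋l₀)

  agree : X ≗ J
  agree l with X l in Xl
  ... | true  = sym (trans (sym (satRuleᵇ-fact {J = J} l))
                  (holds (countermodel-∈ˡ l Xl) (trans (satRuleᵇ-fact {J = Y} l) (X⊆Y l Xl)) refl))
  ... | false with J l in Jl
  ...   | false = refl
  ...   | true with () ← trans (sym Jl₀)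
                          (⇐-mp {J = J} (holds (countermodel-∈ˡ l Xl) (⇐-by-head {J = Y} Yl₀) refl) Jl)

Stable-++-transfer : ∀ (P Q R : LPMLN W n) →
  (∀ X Y → SEModel Q X Y → SEModel P X Y) → Stable (P ++ R) I → Stable (Q ++ R) I
Stable-++-transfer {I = I} P Q R SE-Q⊆SE-P (cI , _ , I-minimal) =
  cI , ⊨-seReduct-self (Q ++ R) , Q++R-minimal
  where
  Q++R-minimal : ∀ J → J ⊂ˡ I → ¬ J ⊨ seReduct (Q ++ R) I
  Q++R-minimal J J⊂I@(J⊆I , _) J⊨Q++R =
    let J⊨Q , J⊨R = ⊨-seReduct-++⁻ Q R J⊨Q++R
        _ , _ , _ , J⊨P = SE-Q⊆SE-P J I (Consistent-⊆ˡ J⊆I cI , cI , J⊆I , J⊨Q)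
    in I-minimal J J⊂I (⊨-seReduct-++⁺ P R J⊨P J⊨R)

-- W may be empty, so the weight of the countermodel is borrowed from Q, which cannot be empty
-- when X violates its reduct.
weightOf : ∀ (Q : LPMLN W n) → ¬ X ⊨ seReduct Q Y → W
weightOf []            X⊭Q = ⊥-elim (X⊭Q refl)
weightOf ((w , _) ∷ _) _   = w

module _ (P Q : LPMLN W n) (Q++-⊆-P++ : ∀ R I → Stable (Q ++ R) I → Stable (P ++ R) I) where

  ⊂ˡ-SEModel-transfer : Consistent Y → X ⊂ˡ Y → X ⊨ seReduct P Y → ¬ ¬ X ⊨ seReduct Q Y
  ⊂ˡ-SEModel-transfer {Y = Y} {X = X} cY X⊂Y@(X⊆Y , l₀ , Yl₀ , Xl₀) X⊨P X⊭Q =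
    P++R-minimal X X⊂Y (⊨-seReduct-++⁺ P R′ X⊨P (countermodel-SEModel w X Y Xl₀))
    where
    w : W
    w = weightOf {X = X} {Y = Y} Q X⊭Q

    R′ : LPMLN W n
    R′ = weighted w (countermodel X l₀)

    Q++R-minimal : ∀ J → J ⊂ˡ Y → ¬ J ⊨ seReduct (Q ++ R′) Y
    Q++R-minimal J (_ , l₁ , Yl₁ , Jl₁) J⊨Q++R =
      let J⊨Q , J⊨R = ⊨-seReduct-++⁻ Q R′ J⊨Q++R
      in X⊭Q (⊨-resp-≗ (seReduct Q Y) (sym ∘ countermodel-forces w X⊆Y Yl₀ Yl₁ Jl₁ J⊨R) J⊨Q)

    P++R-minimal : ∀ J → J ⊂ˡ Y → ¬ J ⊨ seReduct (P ++ R′) Y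
    P++R-minimal = proj₂ (proj₂ (Q++-⊆-P++ R′ Y (cY , ⊨-seReduct-self (Q ++ R′) , Q++R-minimal)))

  SEModel-transfer : SEModel P X Y → SEModel Q X Y
  SEModel-transfer {X = X} {Y = Y} (cX , cY , X⊆Y , X⊨P) = cX , cY , X⊆Y , X⊨Q
    where
    X⊨Q : X ⊨ seReduct Q Y
    X⊨Q with ⊆ˡ⇒≗⊎⊂ˡ X⊆Y
    ... | inj₁ X≗Y = ⊨-resp-≗ (seReduct Q Y) (sym ∘ X≗Y) (⊨-seReduct-self Q)
    ... | inj₂ X⊂Y = decidable-stable (_ ≟ true) (⊂ˡ-SEModel-transfer cY X⊂Y X⊨P)

lemma3p11 : (W : Set) (n : ℕ) (P Q : LPMLN W n) →
    (SemiStronglyEquiv P Q → SameSE P Q) × (SameSE P Q → SemiStronglyEquiv P Q)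
lemma3p11 W n P Q = SSE⇒SameSE , SameSE⇒SSE
  where
  SSE⇒SameSE : SemiStronglyEquiv P Q → SameSE P Q
  SSE⇒SameSE sse X Y =
    SEModel-transfer P Q (λ R I → proj₂ (sse R I)) , SEModel-transfer Q P (λ R I → proj₁ (sse R I))

  SameSE⇒SSE : SameSE P Q → SemiStronglyEquiv P Q
  SameSE⇒SSE se R I =
    Stable-++-transfer P Q R (λ X Y → proj₂ (se X Y)) , Stable-++-transfer Q P R (λ X Y → proj₁ (se X Y))
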